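{- Let $G$ and $H$ be graphs with $\delta(G)\le\delta(H)$ such that $G\times H$ is connected. Let $S$ be a minimum edge-cut in $G\times H$ and $B$, $W$ the connected components of $(G\times H)-S$. If for every $(x,y)\in V(G\times H)$ either $N_G(x)\times\{y\}\subseteq B$ or $N_G(x)\times\{y\}\subseteq W$, then $S$ is of type 2, 4, 6 or 8.
   Context: The direct product $G\times H$ has vertex set $V(G)\times V(H)$, and $(x_1,y_1)$ is adjacent to $(x_2,y_2)$ if and only if $x_1x_2\in E(G)$ and $y_1y_2\in E(H)$. $\delta(F)$ is the minimum degree and $N_G(x)$ the open neighbourhood of $x$ in $G$. A minimum edge-cut is a minimum-size edge set whose removal disconnects the graph; for connected $G\times H$ its removal leaves exactly two components $B$, $W$. Types (partitions are into pairwise disjoint listed parts): Type 2: $B=V(G)\times B''$ and $W=V(G)\times W''$ for some partition $V(H)=B''\cup W''$. Type 4: there are partitions $V(G)=A_1\cup A_2$ and $V(H)=C_1\cup C_2$ with $\{B,W\}=\{(A_1\times C_1)\cup(A_2\times C_2),\ (A_1\times C_2)\cup(A_2\times C_1)\}$. Type 6: there are partitions $V(G)=A_1\cup A_2$ and $V(H)=C_1\cup C_2\cup C_3$ with $C_3\ne\emptyset$ such that one of $B,W$ equals $(A_1\times C_1)\cup(A_2\times C_2)$ and the other equals $(A_2\times C_1)\cup(A_1\times C_2)\cup(V(G)\times C_3)$. Type 8: there are partitions $V(G)=A_1\cup A_2$ and $V(H)=C_1\cup C_2\cup C_3\cup C_4$ with $C_3,C_4\ne\emptyset$ such that $\{B,W\}=\{(A_1\times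 C_1)\cup(A_2\times C_2)\cup(V(G)\times C_3),\ (A_2\times C_1)\cup(A_1\times C_2)\cup(V(G)\times C_4)\}$. -}

module Defs where

open import Data.Nat using (ℕ; zero; suc; _+_; _*_; _≤_; _<_; _⊓_; ⌊_/2⌋)
open import Data.Fin.Patterns using (0F; 1F; 2F; 3F)
open import Data.Fin using (Fin; zero; suc; combine; remQuot)
open import Data.Bool using (Bool; true; false; _∧_; not; _xor_; if_then_else_)
open import Data.Product using (Σ; _×_; _,_; proj₁; proj₂; ∃)
open import Data.Sum using (_⊎_)
open import Data.Empty using (⊥)
open import Relation.Binary.PropositionalEquality using (_≡_; refl; cong₂)

record Graph : Set where
  field
    n      : ℕ
    adj    : Fin n → Fin n → Bool
    sym    : ∀ x y → adj x y ≡ adj y x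
    irrefl : ∀ x → adj x x ≡ false
open Graph public

count : (k : ℕ) → (Fin k → Bool) → ℕ
count zero    p = 0
count (suc k) p = (if p zero then 1 else 0) + count k (λ i → p (suc i))

-- minimum of a function on Fin k (0 for k = 0, never used there)
minOver : (k : ℕ) → (Fin k → ℕ) → ℕ
minOver zero          f = 0
minOver (suc zero)    f = f zero
minOver (suc (suc k)) f = f zero ⊓ minOver (suc k) (λ i → f (suc i))

deg : (G : Graph) → Fin (n G) → ℕ
deg G x = count (n G) (adj G x)

δ : Graph → ℕ
δ G = minOver (n G) (deg G)

-- Direct product G × H: vertex (x , y) is encoded as combine x y.

private
  ∧-irr : ∀ a {b} → a ≡ false → (a ∧ b) ≡ false
  ∧-irr .false refl = refl

pr₁ : (G H : Graph) → Fin (n G * n H) → Fin (n G)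
pr₁ G H u = proj₁ (remQuot {n G} (n H) u)

pr₂ : (G H : Graph) → Fin (n G * n H) → Fin (n H)
pr₂ G H u = proj₂ (remQuot {n G} (n H) u)

_⊗_ : Graph → Graph → Graph
G ⊗ H = record
  { n      = n G * n H
  ; adj    = λ u v → adj G (pr₁ G H u) (pr₁ G H v) ∧ adj H (pr₂ G H u) (pr₂ G H v)
  ; sym    = λ u v → cong₂ _∧_ (sym G (pr₁ G H u) (pr₁ G H v)) (sym H (pr₂ G H u) (pr₂ G H v))
  ; irrefl = λ u → ∧-irr _ (irrefl G (pr₁ G H u))
  }

data Reach {k : ℕ} (E : Fin k → Fin k → Bool) : Fin k → Fin k → Set where
  here : ∀ {u} → Reach E u u
  step : ∀ {u w v} → E u w ≡ true → Reach E w v → Reach E u v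

ConnectedRel : (k : ℕ) → (Fin k → Fin k → Bool) → Set
ConnectedRel k E = (0 < k) × (∀ u v → Reach E u v)

Connected : Graph → Set
Connected Γ = ConnectedRel (n Γ) (adj Γ)

EdgeSet : Graph → Set
EdgeSet Γ = Fin (n Γ) → Fin (n Γ) → Bool

IsEdgeSet : (Γ : Graph) → EdgeSet Γ → Set
IsEdgeSet Γ S = (∀ u v → S u v ≡ S v u) × (∀ u v → S u v ≡ true → adj Γ u v ≡ true)

-- number of (unordered) edges in S
size : (Γ : Graph) → EdgeSet Γ → ℕ
size Γ S = ⌊ sumPairs /2⌋
  where
  sumPairs : ℕ
  sumPairs = go (n Γ) (λ u → count (n Γ) (S u))
    where
    go : (k : ℕ) → (Fin k → ℕ) → ℕ
    go zero    f = 0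
    go (suc k) f = f zero + go k (λ i → f (suc i))

remove : (Γ : Graph) → EdgeSet Γ → Fin (n Γ) → Fin (n Γ) → Bool
remove Γ S u v = adj Γ u v ∧ not (S u v)

IsEdgeCut : (Γ : Graph) → EdgeSet Γ → Set
IsEdgeCut Γ S = IsEdgeSet Γ S × (ConnectedRel (n Γ) (remove Γ S) → ⊥)

IsMinEdgeCut : (Γ : Graph) → EdgeSet Γ → Set
IsMinEdgeCut Γ S = IsEdgeCut Γ S × (∀ S′ → IsEdgeCut Γ S′ → size Γ S ≤ size Γ S′)

AreTheTwoComponents : (k : ℕ) → (Fin k → Fin k → Bool) → (Fin k → Bool) → (Fin k → Bool) → Set
AreTheTwoComponents k E B W =
    (∀ v → B v ≡ true ⊎ W v ≡ true)
  × (∀ v → B v ≡ true → W v ≡ true → ⊥)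
  × (∃ λ v → B v ≡ true) × (∃ λ v → W v ≡ true)
  × (∀ u v → B u ≡ true → B v ≡ true → Reach E u v)
  × (∀ u v → W u ≡ true → W v ≡ true → Reach E u v)
  × (∀ u v → B u ≡ true → W v ≡ true → E u v ≡ false)

_≐_ : {G H : Graph} → (Fin (n (G ⊗ H)) → Bool) → (Fin (n G) → Fin (n H) → Bool) → Set
_≐_ {G} {H} X P = ∀ (x : Fin (n G)) (y : Fin (n H)) → X (combine x y) ≡ P x y

-- Partitions into listed (possibly empty, pairwise disjoint) parts are
-- labellings: A x = true means x ∈ A₁, false means x ∈ A₂;
-- C y = i means y ∈ C_{i+1}.

Type2 : (G H : Graph) → (B W : Fin (n (G ⊗ H)) → Bool) → Set
Type2 G H B W = Σ (Fin (n H) → Bool) λ C →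
  (_≐_ {G} {H} B (λ x y → C y)) × (_≐_ {G} {H} W (λ x y → not (C y)))

-- (A₁ × C₁) ∪ (A₂ × C₂), for a two-part partition of V(H)
t4-X : ∀ {G H : Graph} → (Fin (n G) → Bool) → (Fin (n H) → Bool) → Fin (n G) → Fin (n H) → Bool
t4-X A C x y = not (A x xor C y)

Type4 : (G H : Graph) → (B W : Fin (n (G ⊗ H)) → Bool) → Set
Type4 G H B W = Σ (Fin (n G) → Bool) λ A → Σ (Fin (n H) → Bool) λ C →
    ((_≐_ {G} {H} B (t4-X {G} {H} A C)) × (_≐_ {G} {H} W (λ x y → not (t4-X {G} {H} A C x y))))
  ⊎ ((_≐_ {G} {H} W (t4-X {G} {H} A C)) × (_≐_ {G} {H} B (λ x y → not (t4-X {G} {H} A C x y))))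

-- (A₁ × C₁) ∪ (A₂ × C₂)
t6-X1 : Bool → Fin 3 → Bool
t6-X1 a 0F = a
t6-X1 a 1F = not a
t6-X1 a 2F = false

-- (A₂ × C₁) ∪ (A₁ × C₂) ∪ (V(G) × C₃)
t6-X2 : Bool → Fin 3 → Bool
t6-X2 a 0F = not a
t6-X2 a 1F = a
t6-X2 a 2F = true

Type6 : (G H : Graph) → (B W : Fin (n (G ⊗ H)) → Bool) → Set
Type6 G H B W = Σ (Fin (n G) → Bool) λ A → Σ (Fin (n H) → Fin 3) λ C →
    (∃ λ y → C y ≡ 2F)
  × ( ((_≐_ {G} {H} B (λ x y → t6-X1 (A x) (C y))) × (_≐_ {G} {H} W (λ x y → t6-X2 (A x) (C y))))
    ⊎ ((_≐_ {G} {H} W (λ x y → t6-X1 (A x) (C y))) × (_≐_ {G} {H} B (λ x y → t6-X2 (A x) (C y)))))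

-- (A₁ × C₁) ∪ (A₂ × C₂) ∪ (V(G) × C₃)
t8-X1 : Bool → Fin 4 → Bool
t8-X1 a 0F = a
t8-X1 a 1F = not a
t8-X1 a 2F = true
t8-X1 a 3F = false

-- (A₂ × C₁) ∪ (A₁ × C₂) ∪ (V(G) × C₄)
t8-X2 : Bool → Fin 4 → Bool
t8-X2 a 0F = not a
t8-X2 a 1F = a
t8-X2 a 2F = false
t8-X2 a 3F = true

Type8 : (G H : Graph) → (B W : Fin (n (G ⊗ H)) → Bool) → Set
Type8 G H B W = Σ (Fin (n G) → Bool) λ A → Σ (Fin (n H) → Fin 4) λ C →
    (∃ λ y → C y ≡ 2F) × (∃ λ y → C y ≡ 3F)
  × ( ((_≐_ {G} {H} B (λ x y → t8-X1 (A x) (C y))) × (_≐_ {G} {H} W (λ x y → t8-X2 (A x) (C y))))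
    ⊎ ((_≐_ {G} {H} W (λ x y → t8-X1 (A x) (C y))) × (_≐_ {G} {H} B (λ x y → t8-X2 (A x) (C y)))))

-- The hypothesis says that, for every y, the slice x ↦ [(x , y) ∈ B] is
-- constant on every neighbourhood of G.  Such a function takes the same
-- value at the two ends of any walk of even length, and at the far end of an
-- odd walk from x₀ it takes the value at any neighbour z₀ of x₀.  G is
-- connected (it is a factor of a connected product), so labelling each x by
-- the parity of one chosen walk from x₀ gives a bipartition A of V(G) with
--   (x , y) ∈ B  ⇔  if x ∈ A₁ then (x₀ , y) ∈ B else (z₀ , y) ∈ B.
-- Grouping y by the pair ((x₀ , y) ∈ B , (z₀ , y) ∈ B) gives the four parts
-- C₁ … C₄ of a type 8 cut, and the cut is of type 4 or 6 when C₃ or C₄ is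
-- empty.
module Submission where

open import Defs
open import Data.Nat using (ℕ; _≤_)
open import Data.Fin using (Fin; combine)
open import Data.Fin.Properties using (remQuot-combine; any?; _≟_)
open import Data.Fin.Patterns using (0F; 1F; 2F; 3F)
open import Data.Bool using (Bool; true; false; _∧_; not; _xor_; if_then_else_)
open import Data.Bool.Properties using (not-involutive; not-injective; ¬-not)
open import Data.Sum using (_⊎_; inj₁; inj₂)
open import Data.Product using (_,_; proj₁; proj₂; ∃)
open import Data.Empty using (⊥; ⊥-elim)
open import Function using (_∘_)
open import Relation.Nullary using (yes; no)
open import Relation.Binary.PropositionalEquality as ≡
  using (_≡_; _≢_; refl; trans; cong; subst; subst₂)

ConstantOnNeighbourhoods : ∀ {k} {A : Set} → (Fin k → Fin k → Bool) → (Fin k → A) → Set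
ConstantOnNeighbourhoods E h = ∀ x a b → E x a ≡ true → E x b ≡ true → h a ≡ h b

module _ {k : ℕ} {E : Fin k → Fin k → Bool} where

  isEven : ∀ {u v} → Reach E u v → Bool
  isEven here       = true
  isEven (step _ r) = not (isEven r)

  AgreeAlong : {A : Set} → Bool → (Fin k → A) → Fin k → Fin k → Set
  AgreeAlong true  h u v = h u ≡ h v
  AgreeAlong false h u v = ∀ z → E u z ≡ true → h z ≡ h v

  walk-parity : ∀ {A : Set} {h : Fin k → A} {u v} → (∀ a b → E a b ≡ E b a)
    → ConstantOnNeighbourhoods E h → (r : Reach E u v) → AgreeAlong (isEven r) h u v
  walk-parity E-sym h-const here = refl
  walk-parity {u = u} E-sym h-const (step {w = w} e r)
    with isEven r | walk-parity E-sym h-const r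
  ... | true  | hw≡hv = λ z ez → trans (h-const u z w ez e) hw≡hv
  ... | false | nbrs  = nbrs u (trans (E-sym w u) e)

  value-by-parity : ∀ {A : Set} {h : Fin k → A} {x₀ z₀ x} → (∀ a b → E a b ≡ E b a)
    → ConstantOnNeighbourhoods E h → E x₀ z₀ ≡ true
    → (r : Reach E x₀ x) → h x ≡ (if isEven r then h x₀ else h z₀)
  value-by-parity {z₀ = z₀} E-sym h-const e r
    with isEven r | walk-parity E-sym h-const r
  ... | true  | hx₀≡hx = ≡.sym hx₀≡hx
  ... | false | nbrs   = ≡.sym (nbrs z₀ e)

  first-step : ∀ {u v} → Reach E u v → u ≢ v → ∃ λ w → E u w ≡ true
  first-step here       u≢u = ⊥-elim (u≢u refl)
  first-step (step e _) _   = _ , e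

complement-of-partition : ∀ {k} (B W : Fin k → Bool)
  → (∀ v → B v ≡ true ⊎ W v ≡ true) → (∀ v → B v ≡ true → W v ≡ true → ⊥)
  → ∀ v → W v ≡ not (B v)
complement-of-partition B W covers disjoint v = ¬-not W≢B
  where
  W≢B : W v ≢ B v
  W≢B W≡B with covers v
  ... | inj₁ Bv = disjoint v Bv (trans W≡B Bv)
  ... | inj₂ Wv = disjoint v (trans (≡.sym W≡B) Wv) Wv

∧-true-left : ∀ {a b} → a ∧ b ≡ true → a ≡ true
∧-true-left {true} _ = refl

module _ (G H : Graph) where

  pr₁-combine : ∀ x y → pr₁ G H (combine x y) ≡ x
  pr₁-combine x y = cong proj₁ (remQuot-combine {n G} {n H} x y)

  adj-pr₁ : ∀ {u v} → adj (G ⊗ H) u v ≡ true → adj G (pr₁ G H u) (pr₁ G H v) ≡ true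
  adj-pr₁ = ∧-true-left

  Reach-pr₁ : ∀ {u v} → Reach (adj (G ⊗ H)) u v → Reach (adj G) (pr₁ G H u) (pr₁ G H v)
  Reach-pr₁ here       = here
  Reach-pr₁ (step e r) = step (adj-pr₁ e) (Reach-pr₁ r)

  factor-reach : Connected (G ⊗ H) → Fin (n H) → ∀ x x′ → Reach (adj G) x x′
  factor-reach (_ , reach) y x x′ =
    subst₂ (Reach (adj G)) (pr₁-combine x y) (pr₁-combine x′ y)
      (Reach-pr₁ (reach (combine x y) (combine x′ y)))

t8-X2≡not-t8-X1 : ∀ a c → t8-X2 a c ≡ not (t8-X1 a c)
t8-X2≡not-t8-X1 a 0F = refl
t8-X2≡not-t8-X1 a 1F = ≡.sym (not-involutive a)
t8-X2≡not-t8-X1 a 2F = refl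
t8-X2≡not-t8-X1 a 3F = refl

t6-X2≡not-t6-X1 : ∀ a c → t6-X2 a c ≡ not (t6-X1 a c)
t6-X2≡not-t6-X1 a 0F = refl
t6-X2≡not-t6-X1 a 1F = ≡.sym (not-involutive a)
t6-X2≡not-t6-X1 a 2F = refl

t6-X1≡not-t6-X2 : ∀ a c → t6-X1 a c ≡ not (t6-X2 a c)
t6-X1≡not-t6-X2 a 0F = ≡.sym (not-involutive a)
t6-X1≡not-t6-X2 a 1F = refl
t6-X1≡not-t6-X2 a 2F = refl

partOf : Bool → Bool → Fin 4
partOf true  false = 0F
partOf false true  = 1F
partOf true  true  = 2F
partOf false false = 3F

if≡t8-X1 : ∀ a t f → (if a then t else f) ≡ t8-X1 a (partOf t f)
if≡t8-X1 true  true  true  = refl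
if≡t8-X1 true  true  false = refl
if≡t8-X1 true  false true  = refl
if≡t8-X1 true  false false = refl
if≡t8-X1 false true  true  = refl
if≡t8-X1 false true  false = refl
if≡t8-X1 false false true  = refl
if≡t8-X1 false false false = refl

-- Relabellings of the parts of a type 8 cut when C₃ (resp. C₄, resp. both) is empty.
without2F : Fin 4 → Fin 3
without2F 0F = 0F
without2F 1F = 1F
without2F _  = 2F

without3F : Fin 4 → Fin 3
without3F 0F = 1F
without3F 1F = 0F
without3F _  = 2F

isC₁ : Fin 4 → Bool
isC₁ 0F = true
isC₁ _  = false

t8-X1-without2F : ∀ a c → c ≢ 2F → t8-X1 a c ≡ t6-X1 a (without2F c)
t8-X1-without2F a 0F _   = refl
t8-X1-without2F a 1F _   = refl
t8-X1-without2F a 2F c≢2 = ⊥-elim (c≢2 refl)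
t8-X1-without2F a 3F _   = refl

t8-X1-without3F : ∀ a c → c ≢ 3F → t8-X1 a c ≡ t6-X2 a (without3F c)
t8-X1-without3F a 0F _   = refl
t8-X1-without3F a 1F _   = refl
t8-X1-without3F a 2F _   = refl
t8-X1-without3F a 3F c≢3 = ⊥-elim (c≢3 refl)

t8-X1-isC₁ : ∀ a c → c ≢ 2F → c ≢ 3F → t8-X1 a c ≡ not (a xor isC₁ c)
t8-X1-isC₁ true  0F _   _   = refl
t8-X1-isC₁ false 0F _   _   = refl
t8-X1-isC₁ true  1F _   _   = refl
t8-X1-isC₁ false 1F _   _   = refl
t8-X1-isC₁ a     2F c≢2 _   = ⊥-elim (c≢2 refl)
t8-X1-isC₁ a     3F _   c≢3 = ⊥-elim (c≢3 refl)

module Complementary (G H : Graph) (B W : Fin (n (G ⊗ H)) → Bool)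
                     (W≡not-B : ∀ v → W v ≡ not (B v)) where

  _≐ᴳᴴ_ : (Fin (n (G ⊗ H)) → Bool) → (Fin (n G) → Fin (n H) → Bool) → Set
  _≐ᴳᴴ_ = _≐_ {G} {H}

  ≐-complement : ∀ {P Q} → B ≐ᴳᴴ P → (∀ x y → Q x y ≡ not (P x y)) → W ≐ᴳᴴ Q
  ≐-complement B≐P Q≡not-P x y = trans (W≡not-B _) (trans (cong not (B≐P x y)) (≡.sym (Q≡not-P x y)))

  ≐-pointwise : ∀ {P Q} → B ≐ᴳᴴ P → (∀ x y → P x y ≡ Q x y) → B ≐ᴳᴴ Q
  ≐-pointwise B≐P P≡Q x y = trans (B≐P x y) (P≡Q x y)

  type8-pattern-classified : (A : Fin (n G) → Bool) (C : Fin (n H) → Fin 4)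
    → B ≐ᴳᴴ (λ x y → t8-X1 (A x) (C y))
    → Type4 G H B W ⊎ Type6 G H B W ⊎ Type8 G H B W
  type8-pattern-classified A C B≐X with any? (λ y → C y ≟ 2F) | any? (λ y → C y ≟ 3F)
  ... | yes C₃≠∅ | yes C₄≠∅ = inj₂ (inj₂ (A , C , C₃≠∅ , C₄≠∅ , inj₁
          (B≐X , ≐-complement B≐X (λ x y → t8-X2≡not-t8-X1 (A x) (C y)))))
  ... | no C₃=∅ | yes (y₄ , Cy₄≡3) = inj₂ (inj₁ (A , without2F ∘ C , (y₄ , cong without2F Cy₄≡3) , inj₁
          (B≐X₁ , ≐-complement B≐X₁ (λ x y → t6-X2≡not-t6-X1 (A x) (without2F (C y))))))
    where
    B≐X₁ : B ≐ᴳᴴ (λ x y → t6-X1 (A x) (without2F (C y)))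
    B≐X₁ = ≐-pointwise B≐X (λ x y → t8-X1-without2F (A x) (C y) (λ eq → C₃=∅ (y , eq)))
  ... | yes (y₃ , Cy₃≡2) | no C₄=∅ = inj₂ (inj₁ (A , without3F ∘ C , (y₃ , cong without3F Cy₃≡2) , inj₂
          (≐-complement B≐X₂ (λ x y → t6-X1≡not-t6-X2 (A x) (without3F (C y))) , B≐X₂)))
    where
    B≐X₂ : B ≐ᴳᴴ (λ x y → t6-X2 (A x) (without3F (C y)))
    B≐X₂ = ≐-pointwise B≐X (λ x y → t8-X1-without3F (A x) (C y) (λ eq → C₄=∅ (y , eq)))
  ... | no C₃=∅ | no C₄=∅ = inj₁ (A , isC₁ ∘ C , inj₁ (B≐X₄ , ≐-complement B≐X₄ (λ _ _ → refl)))
    where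
    B≐X₄ : B ≐ᴳᴴ t4-X {G} {H} A (isC₁ ∘ C)
    B≐X₄ = ≐-pointwise B≐X (λ x y →
      t8-X1-isC₁ (A x) (C y) (λ eq → C₃=∅ (y , eq)) (λ eq → C₄=∅ (y , eq)))

  slice-constant : (∀ x y → (∀ x′ → adj G x x′ ≡ true → B (combine x′ y) ≡ true)
                          ⊎ (∀ x′ → adj G x x′ ≡ true → W (combine x′ y) ≡ true))
    → ∀ y → ConstantOnNeighbourhoods (adj G) (λ x → B (combine x y))
  slice-constant one-side y x a b ea eb with one-side x y
  ... | inj₁ in-B = trans (in-B a ea) (≡.sym (in-B b eb))
  ... | inj₂ in-W = not-injective (begin
    not (B (combine a y)) ≡⟨ ≡.sym (W≡not-B _) ⟩
    W (combine a y)       ≡⟨ trans (in-W a ea) (≡.sym (in-W b eb)) ⟩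
    W (combine b y)       ≡⟨ W≡not-B _ ⟩
    not (B (combine b y)) ∎)
    where open ≡.≡-Reasoning

corollary2p8 : (G H : Graph) → δ G ≤ δ H → Connected (G ⊗ H)
    → (S : EdgeSet (G ⊗ H)) → IsMinEdgeCut (G ⊗ H) S
    → (B W : Fin (n (G ⊗ H)) → Bool)
    → AreTheTwoComponents (n (G ⊗ H)) (remove (G ⊗ H) S) B W
    → (∀ x y → (∀ x′ → adj G x x′ ≡ true → B (combine x′ y) ≡ true)
    ⊎ (∀ x′ → adj G x x′ ≡ true → W (combine x′ y) ≡ true))
    → Type2 G H B W ⊎ Type4 G H B W ⊎ Type6 G H B W ⊎ Type8 G H B W
corollary2p8 G H _ connected _ _ B W (covers , disjoint , (b , b∈B) , (w , w∈W) , _) one-side =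
  inj₂ (type8-pattern-classified A C B≐X)
  where
  open Complementary G H B W (complement-of-partition B W covers disjoint)
  x₀ : Fin (n G)
  x₀ = pr₁ G H b
  edge-at-x₀ : ∃ λ z₀ → adj G x₀ z₀ ≡ true
  edge-at-x₀ with first-step (proj₂ connected b w) b≢w
    where b≢w : b ≢ w
          b≢w b≡w = disjoint b b∈B (subst (λ v → W v ≡ true) (≡.sym b≡w) w∈W)
  ... | v , e = pr₁ G H v , adj-pr₁ G H e
  z₀ : Fin (n G)
  z₀ = proj₁ edge-at-x₀
  walk : ∀ x → Reach (adj G) x₀ x
  walk = factor-reach G H connected (pr₂ G H b) x₀
  A : Fin (n G) → Bool
  A x = isEven (walk x)
  C : Fin (n H) → Fin 4
  C y = partOf (B (combine x₀ y)) (B (combine z₀ y))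
  B≐X : B ≐ᴳᴴ (λ x y → t8-X1 (A x) (C y))
  B≐X x y = trans (value-by-parity (sym G) (slice-constant one-side y) (proj₂ edge-at-x₀) (walk x))
                  (if≡t8-X1 (A x) _ _)
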